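{- Let $DOM(G;X)=\sum_{A\subseteq V(G):\,A\text{ is a dominating set of }G}X^{|A|}$. There is no graph property $\mathcal{C}$ such that $DOM(G;X)=\chi_{\mathcal{C}}(G;X)$ for all graphs $G$.
   Context: All graphs are finite without multiple edges. A set $A\subseteq V(G)$ is dominating if every vertex not in $A$ has a neighbor in $A$. A graph property is an isomorphism-closed class of graphs. For a graph property $\mathcal{C}$ and $k\in\mathbb{N}$, $\chi_{\mathcal{C}}(G;k)$ is the number of maps $f:V(G)\to\{1,\dots,k\}$ such that each nonempty color class $f^{ -1}(c)$ induces a graph in $\mathcal{C}$; it is known to be a polynomial in $k$, denoted $\chi_{\mathcal{C}}(G;X)$. -}

module Defs where

open import Data.Nat using (ℕ; zero; suc; _+_; _^_)
open import Data.Bool using (Bool; true; false; _∧_; _∨_; not; if_then_else_)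
open import Data.Fin using (Fin; zero; suc)
open import Data.Fin.Properties using (_≟_)
open import Data.List using (List; []; _∷_; map; filter; length; allFin; concatMap)
open import Data.Bool.ListAction using (all; any)
open import Data.Nat.ListAction using (sum)
open import Data.Vec using (Vec; lookup; fromList)
open import Relation.Nullary.Decidable using (⌊_⌋)
open import Relation.Binary.PropositionalEquality using (_≡_)
open import Function.Bundles using (_↔_; Inverse)

record Graph (n : ℕ) : Set where
  field
    adj    : Fin n → Fin n → Bool
    sym    : ∀ i j → adj i j ≡ adj j i
    irrefl : ∀ i → adj i i ≡ false
open Graph public

-- A graph property: a (classically decidable) class of graphs, closed under isomorphism.
GraphClass : Set
GraphClass = ∀ n → Graph n → Bool

IsoClosed : GraphClass → Set
IsoClosed C = ∀ {n m} (G : Graph n) (H : Graph m) (σ : Fin n ↔ Fin m) →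
  (∀ i j → adj H (Inverse.to σ i) (Inverse.to σ j) ≡ adj G i j) →
  C n G ≡ C m H

-- Induced subgraph on a list of (distinct) vertices.
induced : ∀ {n} → Graph n → (vs : List (Fin n)) → Graph (length vs)
induced G vs = record
  { adj    = λ i j → adj G (lookup (fromList vs) i) (lookup (fromList vs) j)
  ; sym    = λ i j → sym G _ _
  ; irrefl = λ i → irrefl G _ }

colorClass : ∀ {n k} → (Fin n → Fin k) → Fin k → List (Fin n)
colorClass {n} f c = filter (λ v → f v ≟ c) (allFin n)

isEmpty : ∀ {A : Set} → List A → Bool
isEmpty [] = true
isEmpty (_ ∷ _) = false

allFuns : (n k : ℕ) → List (Fin n → Fin k)
allFuns zero    k = (λ ()) ∷ []
allFuns (suc n) k =
  concatMap (λ c → map (λ g → λ { zero → c ; (suc i) → g i }) (allFuns n k)) (allFin k)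

isCColoring : ∀ {n k} → GraphClass → Graph n → (Fin n → Fin k) → Bool
isCColoring {n} {k} C G f =
  all (λ c → isEmpty (colorClass f c) ∨ C _ (induced G (colorClass f c))) (allFin k)

chiC : GraphClass → ∀ {n} → Graph n → ℕ → ℕ
chiC C {n} G k = length (filter (λ f → Data.Bool._≟_ (isCColoring C G f) true) (allFuns n k))

allSubsets : (n : ℕ) → List (Fin n → Bool)
allSubsets zero    = (λ ()) ∷ []
allSubsets (suc n) =
  concatMap (λ b → map (λ g → λ { zero → b ; (suc i) → g i }) (allSubsets n)) (true ∷ false ∷ [])

size : ∀ {n} → (Fin n → Bool) → ℕ
size {n} A = length (filter (λ v → Data.Bool._≟_ (A v) true) (allFin n))

isDominating : ∀ {n} → Graph n → (Fin n → Bool) → Bool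
isDominating {n} G A = all (λ v → A v ∨ any (λ u → A u ∧ adj G v u) (allFin n)) (allFin n)

DOM : ∀ {n} → Graph n → ℕ → ℕ
DOM {n} G x = sum (map (λ A → if isDominating G A then x ^ size A else 0) (allSubsets n))

-- With a single colour there is only one map V(G) → {1}, so χ_C(G;1) ≤ 1 for every
-- property C, whereas DOM(G;1) counts the dominating sets of G, and K₂ has three.
module Submission where

open import Defs
open import Data.Nat using (ℕ; zero; suc; _≤_; s≤s)
open import Data.Nat.Properties using (≤-trans; ≤-reflexive; module ≤-Reasoning)
open import Data.Bool using (Bool; true; false)
open import Data.Fin using (Fin; zero; suc)
open import Data.List using ([]; length; map; _++_)
open import Data.List.Properties using (length-filter; length-map; ++-identityʳ)
open import Data.Product using (Σ; _×_; _,_)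
open import Relation.Nullary using (¬_)
open import Relation.Binary.PropositionalEquality using (_≡_; refl; trans; cong)
  renaming (sym to ≡-sym)

length-map-++-[] : ∀ {A B : Set} (f : A → B) xs → length (map f xs ++ []) ≡ length xs
length-map-++-[] f xs = trans (cong length (++-identityʳ (map f xs))) (length-map f xs)

-- allFuns (suc n) 1 reduces to  map _ (allFuns n 1) ++ [] : the only colour is prepended.
length-allFuns-1 : ∀ n → length (allFuns n 1) ≡ 1
length-allFuns-1 zero    = refl
length-allFuns-1 (suc n) = trans (length-map-++-[] _ (allFuns n 1)) (length-allFuns-1 n)

chiC-1≤1 : ∀ C {n} (G : Graph n) → chiC C G 1 ≤ 1
chiC-1≤1 C {n} G = ≤-trans (length-filter _ (allFuns n 1)) (≤-reflexive (length-allFuns-1 n))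

K₂ : Graph 2
K₂ = record { adj = edge ; sym = edge-sym ; irrefl = edge-irrefl }
  where
  edge : Fin 2 → Fin 2 → Bool
  edge zero       zero       = false
  edge (suc zero) (suc zero) = false
  edge _          _          = true

  edge-sym : ∀ i j → edge i j ≡ edge j i
  edge-sym zero       zero       = refl
  edge-sym zero       (suc zero) = refl
  edge-sym (suc zero) zero       = refl
  edge-sym (suc zero) (suc zero) = refl

  edge-irrefl : ∀ i → edge i i ≡ false
  edge-irrefl zero       = refl
  edge-irrefl (suc zero) = refl

DOM-K₂-1 : DOM K₂ 1 ≡ 3
DOM-K₂-1 = refl

theorem16 : ¬ (Σ GraphClass λ C → IsoClosed C × (∀ n (G : Graph n) (k : ℕ) → DOM G k ≡ chiC C G k))
theorem16 (C , _ , DOM≡chiC) = 3≰1 (begin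
  3           ≡⟨ ≡-sym DOM-K₂-1 ⟩
  DOM K₂ 1    ≡⟨ DOM≡chiC 2 K₂ 1 ⟩
  chiC C K₂ 1 ≤⟨ chiC-1≤1 C K₂ ⟩
  1           ∎)
  where
  open ≤-Reasoning
  3≰1 : ¬ 3 ≤ 1
  3≰1 (s≤s ())
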